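{- The rules R4 and R6 preserve validity. That is: (i) for all $G\subseteq A$ and $\varphi\in\mathcal{L}_{CoGAL}$, if $\varphi$ is valid then $[\!\langle G\rangle\!]\varphi$ is valid; (ii) for every necessity form $\eta$, $G\subseteq A$ and $\varphi\in\mathcal{L}_{CoGAL}$, if for every $\psi\in\mathcal{L}_{EL}^G$ there exists $\chi\in\mathcal{L}_{EL}^{A\setminus G}$ such that $\eta(\psi\to\langle\psi\wedge\chi\rangle\varphi)$ is valid, then $\eta([\!\langle G\rangle\!]\varphi)$ is valid.
   Context: Fix a finite set of agents $A$ and a countable set $P$ of propositional variables. The language $\mathcal{L}_{CoGAL}$ is given by $\varphi ::= p \mid \neg\varphi \mid (\varphi\wedge\varphi) \mid K_a\varphi \mid [\varphi]\varphi \mid [G]\varphi \mid [\!\langle G\rangle\!]\varphi$ with $p\in P$, $a\in A$, $G\subseteq A$; usual propositional abbreviations; $\langle\varphi\rangle\psi=\neg[\varphi]\neg\psi$. $\mathcal{L}_{EL}$ is the fragment built from $p,\neg,\wedge,K_a$ only. For $G\subseteq A$, $\mathcal{L}_{EL}^G$ is the set of formulas $\bigwedge_{i\in G}K_i\varphi_i$ with each $\varphi_i\in\mathcal{L}_{EL}$. An epistemic model is $M=(W,\sim,V)$ with $W\neq\emptyset$, $\sim_a$ an equivalence relation on $W$ for each $a\in A$, $V:P\to\mathcal P(W)$. Semantics at $(M,w)$: $p$ iff $w\in V(p)$; Boolean clauses as usual; $K_a\varphi$ iff $(M,v)\models\varphi$ for all $v$ with $w\sim_a v$; $[\varphi]\psi$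 iff $(M,w)\models\varphi$ implies $(M^\varphi,w)\models\psi$, where $M^\varphi$ is the restriction of $M$ to $\llbracket\varphi\rrbracket_M=\{v:(M,v)\models\varphi\}$; $[G]\varphi$ iff for all $\psi\in\mathcal{L}_{EL}^G$, $(M,w)\models[\psi]\varphi$; $[\!\langle G\rangle\!]\varphi$ iff for all $\psi\in\mathcal{L}_{EL}^G$ there is $\chi\in\mathcal{L}_{EL}^{A\setminus G}$ with $(M,w)\models\psi\to\langle\psi\wedge\chi\rangle\varphi$. A formula is valid if true at every pointed model $(M,w)$. Necessity forms: $\eta ::= \sharp \mid \varphi\to\eta(\sharp)\mid K_a\eta(\sharp)\mid[\varphi]\eta(\sharp)$ ($\varphi\in\mathcal{L}_{CoGAL}$), with a unique occurrence of $\sharp$; $\eta(\varphi)$ is the result of replacing $\sharp$ by $\varphi$. -}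

module Defs where

open import Data.Nat using (ℕ)
open import Data.Fin using (Fin)
open import Data.Fin.Subset using (Subset; ∁)
open import Data.Fin.Subset.Properties using (_∈?_)
open import Data.List using (List; foldr; allFin)
open import Data.Bool using (if_then_else_)
open import Data.Product using (Σ; _×_; _,_)
open import Relation.Nullary using (¬_; does)
open import Relation.Binary using (IsEquivalence)

-- Agents are Fin n (a finite set A), propositional variables are ℕ,
-- coalitions G ⊆ A are Subset n.

data EL (n : ℕ) : Set where
  var  : ℕ → EL n
  ~_   : EL n → EL n
  _∧_  : EL n → EL n → EL n
  K    : Fin n → EL n → EL n

data Form (n : ℕ) : Set where
  var  : ℕ → Form n
  ~_   : Form n → Form n
  _∧_  : Form n → Form n → Form n
  K    : Fin n → Form n → Form n
  ann  : Form n → Form n → Form n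
  gbox : Subset n → Form n → Form n
  coal : Subset n → Form n → Form n

infixr 6 _∧_
infix 7 ~_

embed : ∀ {n} → EL n → Form n
embed (var p) = var p
embed (~ φ) = ~ embed φ
embed (φ ∧ ψ) = embed φ ∧ embed ψ
embed (K a φ) = K a (embed φ)

_⇒_ : ∀ {n} → Form n → Form n → Form n
φ ⇒ ψ = ~ (φ ∧ ~ ψ)

⟨_⟩_ : ∀ {n} → Form n → Form n → Form n
⟨ φ ⟩ ψ = ~ ann φ (~ ψ)

⊤EL : ∀ {n} → EL n
⊤EL = ~ (var 0 ∧ ~ var 0)

-- The formula ⋀_{i ∈ G} K_i (ψs i) of L_EL^G (taken in the order of
-- the agents; the empty conjunction is ⊤).
conjG : ∀ {n} → Subset n → (Fin n → EL n) → EL n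
conjG {n} G ψs =
  foldr (λ i rest → if does (i ∈? G) then (K i (ψs i) ∧ rest) else rest)
        ⊤EL (allFin n)

record Model (n : ℕ) : Set₁ where
  field
    W     : Set
    R     : Fin n → W → W → Set
    isEq  : ∀ a → IsEquivalence (R a)
    V     : ℕ → W → Set

open Model public

restrict : ∀ {n} (M : Model n) → (W M → Set) → Model n
restrict M P = record
  { W = Σ (W M) P
  ; R = λ a x y → R M a (Data.Product.proj₁ x) (Data.Product.proj₁ y)
  ; isEq = λ a → record
      { refl = IsEquivalence.refl (isEq M a)
      ; sym = IsEquivalence.sym (isEq M a)
      ; trans = IsEquivalence.trans (isEq M a) }
  ; V = λ p x → V M p (Data.Product.proj₁ x)
  }

satEL : ∀ {n} (M : Model n) → W M → EL n → Set
satEL M w (var p) = V M p w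
satEL M w (~ φ) = ¬ satEL M w φ
satEL M w (φ ∧ ψ) = satEL M w φ × satEL M w ψ
satEL M w (K a φ) = ∀ v → R M a w v → satEL M v φ

sat : ∀ {n} (M : Model n) → W M → Form n → Set
sat M w (var p) = V M p w
sat M w (~ φ) = ¬ sat M w φ
sat M w (φ ∧ ψ) = sat M w φ × sat M w ψ
sat M w (K a φ) = ∀ v → R M a w v → sat M v φ
sat M w (ann φ ψ) =
  (h : sat M w φ) → sat (restrict M (λ v → sat M v φ)) (w , h) ψ
sat {n} M w (gbox G φ) =
  (ψs : Fin n → EL n) →
  (h : satEL M w (conjG G ψs)) →
  sat (restrict M (λ v → satEL M v (conjG G ψs))) (w , h) φ
-- [⟨G⟩]φ : for all ψ ∈ L_EL^G there is χ ∈ L_EL^(A∖G) with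
--          (M,w) ⊨ ψ → ⟨ψ ∧ χ⟩φ,  where ⟨θ⟩φ = ¬[θ]¬φ
sat {n} M w (coal G φ) =
  (ψs : Fin n → EL n) → Σ (Fin n → EL n) λ χs →
  ¬ (satEL M w (conjG G ψs) ×
     ¬ ¬ ((h : satEL M w (conjG G ψs ∧ conjG (∁ G) χs)) →
          ¬ sat (restrict M (λ v → satEL M v (conjG G ψs ∧ conjG (∁ G) χs)))
                (w , h) φ))

Valid : ∀ {n} → Form n → Set₁
Valid {n} φ = (M : Model n) (w : W M) → sat M w φ

data NF (n : ℕ) : Set where
  ♯    : NF n
  imp  : Form n → NF n → NF n
  Kη   : Fin n → NF n → NF n
  annη : Form n → NF n → NF n

fill : ∀ {n} → NF n → Form n → Form n
fill ♯ X = X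
fill (imp φ η) X = φ ⇒ fill η X
fill (Kη a η) X = K a (fill η X)
fill (annη φ η) X = ann φ (fill η X)

-- Truth is invariant under bisimulation, so restricting a model to the
-- EL-semantics of ψ ∧ χ or to the CoGAL-semantics of its embedding gives
-- indistinguishable models; hence if, for every ψ ∈ L_EL^G, some χ makes
-- ψ → ⟨ψ ∧ χ⟩φ true at a world, then [⟨G⟩]φ is true there. For R4 take
-- χ = ⊤, which does not shrink the model. For R6, truth of η(θ) at a world
-- is monotone in θ, also for a conclusion entailed by infinitely many
-- premises θ ψ at once, provided each θ ψ is ¬¬-stable (implications are):
-- constructively, the case φ → η(♯) only yields ¬ ¬ η(θ ψ) for each ψ.
module Submission where

open import Defs
open import Data.Fin using (Fin)
open import Data.Fin.Subset using (Subset; ∁)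
open import Data.Fin.Subset.Properties using (_∈?_)
open import Data.Product using (Σ; _×_; _,_; proj₁; proj₂)
open import Data.List using (List; []; _∷_; foldr; allFin)
open import Data.Bool using (true; false; if_then_else_)
open import Relation.Nullary using (¬_; does)
open import Relation.Nullary.Negation using (Stable; negated-stable; ¬¬-map)
open import Relation.Binary.PropositionalEquality using (_≡_; refl)

record Bisimulation {n} (M N : Model n) : Set₁ where
  field
    Z     : W M → W N → Set
    atom⁺ : ∀ {w v p} → Z w v → V M p w → V N p v
    atom⁻ : ∀ {w v p} → Z w v → V N p v → V M p w
    forth : ∀ {a w v w′} → Z w v → R M a w w′ → Σ (W N) λ v′ → R N a v v′ × Z w′ v′
    back  : ∀ {a w v v′} → Z w v → R N a v v′ → Σ (W M) λ w′ → R M a w w′ × Z w′ v′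
open Bisimulation

_⁻¹ : ∀ {n} {M N : Model n} → Bisimulation M N → Bisimulation N M
B ⁻¹ = record { Z = λ v w → Z B w v ; atom⁺ = atom⁻ B ; atom⁻ = atom⁺ B
              ; forth = back B ; back = forth B }

≡-bisimulation : ∀ {n} (M : Model n) → Bisimulation M M
≡-bisimulation M = record
  { Z = _≡_
  ; atom⁺ = λ { refl p → p }
  ; atom⁻ = λ { refl p → p }
  ; forth = λ { {w′ = w′} refl r → w′ , r , refl }
  ; back  = λ { {v′ = v′} refl r → v′ , r , refl }
  }

restrict-bisimulation : ∀ {n} {M N : Model n} (B : Bisimulation M N)
  (P : W M → Set) (Q : W N → Set) →
  (∀ {w v} → Z B w v → P w → Q v) → (∀ {w v} → Z B w v → Q v → P w) →
  Bisimulation (restrict M P) (restrict N Q)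
restrict-bisimulation B P Q P⇒Q Q⇒P = record
  { Z = λ x y → Z B (proj₁ x) (proj₁ y)
  ; atom⁺ = atom⁺ B
  ; atom⁻ = atom⁻ B
  ; forth = λ { {w′ = _ , p} z r → let v′ , r′ , z′ = forth B z r in (v′ , P⇒Q z′ p) , r′ , z′ }
  ; back  = λ { {v′ = _ , q} z r → let w′ , r′ , z′ = back B z r in (w′ , Q⇒P z′ q) , r′ , z′ }
  }

satEL-bisimulation : ∀ {n} {M N : Model n} (B : Bisimulation M N) {w v} →
  Z B w v → (φ : EL n) → satEL M w φ → satEL N v φ
satEL-bisimulation B z (var p) s = atom⁺ B z s
satEL-bisimulation B z (~ φ) s = λ t → s (satEL-bisimulation (B ⁻¹) z φ t)
satEL-bisimulation B z (φ ∧ ψ) (s , t) =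
  satEL-bisimulation B z φ s , satEL-bisimulation B z ψ t
satEL-bisimulation B z (K a φ) s v′ r =
  let w′ , r′ , z′ = back B z r in satEL-bisimulation B z′ φ (s w′ r′)

restrictEL-bisimulation : ∀ {n} {M N : Model n} (B : Bisimulation M N) (θ : EL n) →
  Bisimulation (restrict M λ w → satEL M w θ) (restrict N λ v → satEL N v θ)
restrictEL-bisimulation B θ = restrict-bisimulation B _ _
  (λ z → satEL-bisimulation B z θ) (λ z → satEL-bisimulation (B ⁻¹) z θ)

sat-bisimulation : ∀ {n} {M N : Model n} (B : Bisimulation M N) {w v} →
  Z B w v → (φ : Form n) → sat M w φ → sat N v φ
sat-bisimulation B z (var p) s = atom⁺ B z s
sat-bisimulation B z (~ φ) s = λ t → s (sat-bisimulation (B ⁻¹) z φ t)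
sat-bisimulation B z (φ ∧ ψ) (s , t) =
  sat-bisimulation B z φ s , sat-bisimulation B z ψ t
sat-bisimulation B z (K a φ) s v′ r =
  let w′ , r′ , z′ = back B z r in sat-bisimulation B z′ φ (s w′ r′)
sat-bisimulation B z (ann φ ψ) s h =
  sat-bisimulation B[φ] z ψ (s (sat-bisimulation (B ⁻¹) z φ h))
  where
  B[φ] = restrict-bisimulation B _ _
           (λ z′ → sat-bisimulation B z′ φ) (λ z′ → sat-bisimulation (B ⁻¹) z′ φ)
sat-bisimulation B z (gbox G φ) s ψs h =
  sat-bisimulation (restrictEL-bisimulation B (conjG G ψs)) z φ
    (s ψs (satEL-bisimulation (B ⁻¹) z (conjG G ψs) h))
sat-bisimulation B z (coal G φ) s ψs =
  let χs , k = s ψs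
      θ = conjG G ψs ∧ conjG (∁ G) χs
  in χs , λ { (c , nn) →
       k ( satEL-bisimulation (B ⁻¹) z (conjG G ψs) c
         , ¬¬-map (λ g h s′ → g (satEL-bisimulation B z θ h)
                     (sat-bisimulation (restrictEL-bisimulation B θ) z φ s′)) nn) }

restrict-cong : ∀ {n} (M : Model n) (P Q : W M → Set) →
  (∀ {w} → P w → Q w) → (∀ {w} → Q w → P w) →
  ∀ {w} (p : P w) (q : Q w) (φ : Form n) →
  sat (restrict M P) (w , p) φ → sat (restrict M Q) (w , q) φ
restrict-cong M P Q P⇒Q Q⇒P p q =
  sat-bisimulation (restrict-bisimulation (≡-bisimulation M) P Q
                      (λ { refl → P⇒Q }) (λ { refl → Q⇒P })) refl

satEL⇒sat-embed : ∀ {n} (M : Model n) w (φ : EL n) → satEL M w φ → sat M w (embed φ)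
sat-embed⇒satEL : ∀ {n} (M : Model n) w (φ : EL n) → sat M w (embed φ) → satEL M w φ
satEL⇒sat-embed M w (var p) s = s
satEL⇒sat-embed M w (~ φ) s = λ t → s (sat-embed⇒satEL M w φ t)
satEL⇒sat-embed M w (φ ∧ ψ) (s , t) = satEL⇒sat-embed M w φ s , satEL⇒sat-embed M w ψ t
satEL⇒sat-embed M w (K a φ) s v r = satEL⇒sat-embed M v φ (s v r)
sat-embed⇒satEL M w (var p) s = s
sat-embed⇒satEL M w (~ φ) s = λ t → s (satEL⇒sat-embed M w φ t)
sat-embed⇒satEL M w (φ ∧ ψ) (s , t) = sat-embed⇒satEL M w φ s , sat-embed⇒satEL M w ψ t
sat-embed⇒satEL M w (K a φ) s v r = sat-embed⇒satEL M v φ (s v r)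

satEL-⊤ : ∀ {n} (M : Model n) w → satEL M w ⊤EL
satEL-⊤ M w (p , ¬p) = ¬p p

satEL-conjG-⊤ : ∀ {n} (M : Model n) (G : Subset n) w → satEL M w (conjG G λ _ → ⊤EL)
satEL-conjG-⊤ {n} M G w = conj-⊤ (allFin n)
  where
  conj-⊤ : (is : List (Fin n)) →
    satEL M w (foldr (λ i rest → if does (i ∈? G) then (K i ⊤EL ∧ rest) else rest) ⊤EL is)
  conj-⊤ [] = satEL-⊤ M w
  conj-⊤ (i ∷ is) with does (i ∈? G)
  ... | true  = (λ v _ → satEL-⊤ M v) , conj-⊤ is
  ... | false = conj-⊤ is

coal-intro : ∀ {n} (M : Model n) w (G : Subset n) (φ : Form n) →
  ((ψs : Fin n → EL n) → Σ (Fin n → EL n) λ χs →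
    sat M w (embed (conjG G ψs)
             ⇒ (⟨ embed (conjG G ψs) ∧ embed (conjG (∁ G) χs) ⟩ φ))) →
  sat M w (coal G φ)
coal-intro M w G φ witness ψs =
  χs , λ { (c , nn) →
    k ( satEL⇒sat-embed M w (conjG G ψs) c
      , ¬¬-map (λ g h s → g (sat-embed⇒satEL M w θ h)
                  (restrict-cong M _ _ (λ {v} → sat-embed⇒satEL M v θ)
                                       (λ {v} → satEL⇒sat-embed M v θ) _ _ φ s)) nn) }
  where
  χs = proj₁ (witness ψs)
  k  = proj₂ (witness ψs)
  θ  = conjG G ψs ∧ conjG (∁ G) χs

coal-valid : ∀ {n} (G : Subset n) (φ : Form n) → Valid φ → Valid (coal G φ)
coal-valid G φ ⊨φ M w ψs =
  (λ _ → ⊤EL) , λ { (c , nn) → nn λ g → g (c , satEL-conjG-⊤ M (∁ G) w) (⊨φ _ _) }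

StableForm : ∀ {n} → Form n → Set₁
StableForm {n} φ = (M : Model n) (w : W M) → Stable (sat M w φ)

fill-stable : ∀ {n} (η : NF n) {φ : Form n} → StableForm φ → StableForm (fill η φ)
fill-stable ♯ st = st
fill-stable (imp ψ η) st M w = negated-stable
fill-stable (Kη a η) st M w nn v r =
  fill-stable η st M v (¬¬-map (λ s → s v r) nn)
fill-stable (annη ψ η) st M w nn h =
  fill-stable η st _ (w , h) (¬¬-map (λ s → s h) nn)

fill-mono : ∀ {n} {I : Set} (η : NF n) (φs : I → Form n) (ψ : Form n) →
  (∀ i → StableForm (φs i)) →
  ((M : Model n) (w : W M) → (∀ i → sat M w (φs i)) → sat M w ψ) →
  (M : Model n) (w : W M) → (∀ i → sat M w (fill η (φs i))) → sat M w (fill η ψ)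
fill-mono ♯ φs ψ st entails = entails
fill-mono (imp θ η) φs ψ st entails M w hs (t , ¬ηψ) =
  ¬ηψ (fill-mono η φs ψ st entails M w λ i →
         fill-stable η (st i) M w λ ¬ηφ → hs i (t , ¬ηφ))
fill-mono (Kη a η) φs ψ st entails M w hs v r =
  fill-mono η φs ψ st entails M v λ i → hs i v r
fill-mono (annη θ η) φs ψ st entails M w hs h =
  fill-mono η φs ψ st entails _ (w , h) λ i → hs i h

fill-coal-valid : ∀ {n} (η : NF n) (G : Subset n) (φ : Form n) →
  ((ψs : Fin n → EL n) → Σ (Fin n → EL n) λ χs →
    Valid (fill η (embed (conjG G ψs)
                   ⇒ (⟨ embed (conjG G ψs) ∧ embed (conjG (∁ G) χs) ⟩ φ)))) →
  Valid (fill η (coal G φ))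
fill-coal-valid {n} η G φ witness M w =
  fill-mono η premise (coal G φ) (λ ψs M w → negated-stable)
    (λ M w hs → coal-intro M w G φ λ ψs → proj₁ (witness ψs) , hs ψs)
    M w (λ ψs → proj₂ (witness ψs) M w)
  where
  premise : (Fin n → EL n) → Form n
  premise ψs = embed (conjG G ψs)
               ⇒ (⟨ embed (conjG G ψs) ∧ embed (conjG (∁ G) (proj₁ (witness ψs))) ⟩ φ)

proposition1 : ∀ {n : _} →
    ((G : Subset n) (φ : Form n) → Valid φ → Valid (coal G φ))
    ×
    ((η : NF n) (G : Subset n) (φ : Form n) →
      ((ψs : Fin n → EL n) → Σ (Fin n → EL n) λ χs →
        Valid (fill η (embed (conjG G ψs)
                       ⇒ (⟨ embed (conjG G ψs) ∧ embed (conjG (∁ G) χs) ⟩ φ)))) →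
      Valid (fill η (coal G φ)))
proposition1 = coal-valid , fill-coal-valid
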